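{- Let $\eta=(\eta_0,\ldots,\eta_n)$ be a partial orbit in a meet-tree which is a $k$-spiral (ascending or descending). Then for all $i,j,l\in\{0,\ldots,n\}$: (1) $\eta_i$ is comparable to $\eta_j$ if and only if $i\equiv j\pmod k$; (2) if $i\equiv j\not\equiv l\pmod k$, then $\eta_i\mathbin{\wedge}\eta_l=\eta_j\mathbin{\wedge}\eta_l$; (3) if $2l\leq n$ and $\eta_0\mathbin{\wedge}\eta_l\neq\eta_l\mathbin{\wedge}\eta_{2l}$, then $k$ divides $l$ (so that $\eta_0<\eta_l<\eta_{2l}$ or $\eta_0>\eta_l>\eta_{2l}$).
   Context: A meet-tree is a structure $(A,\leq,\mathbin{\wedge})$ where $\leq$ is a partial order such that each $A_{\leq a}=\{x:x\leq a\}$ is linearly ordered, any two elements have a common lower bound, and $a\mathbin{\wedge} b$ is the largest element of $A_{\leq a}\cap A_{\leq b}$. A partial automorphism is a partial map preserving quantifier-free types over $\emptyset$ (in the language $\{\leq,\mathbin{\wedge}\}$). A (finite) partial orbit is a finite sequence $(\eta_0,\ldots,\eta_n)$ of elements of a meet-tree such that the map $\eta_i\mapsto\eta_{i+1}$ ($i<n$) is a partial automorphism. It is an ascending (resp.\ descending) $k$-spiral if $k$ is the least positive integer such that $\eta_k>\eta_0$ (resp.\ $\eta_k<\eta_0$). -}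

module Defs where

open import Level using (Level; _⊔_)
open import Data.Nat using (ℕ; zero; suc; _+_; _*_; _≤_; _<_; s≤s; ∣_-_∣)
open import Data.Nat.Properties using (≤-trans; m≤m+n; <-trans)
open import Data.Nat.Divisibility using (_∣_)
open import Data.Fin using (Fin; toℕ; fromℕ<; inject₁) renaming (suc to fsuc; zero to fzero)
open import Data.Product using (Σ; ∃; _×_; _,_)
open import Data.Sum using (_⊎_)
open import Relation.Binary.PropositionalEquality using (_≡_; _≢_)
open import Relation.Binary.Structures using (IsPartialOrder)
open import Relation.Nullary using (¬_)

record MeetTree (a ℓ : Level) : Set (Level.suc (a ⊔ ℓ)) where
  infix 4 _≤ₜ_
  infixl 7 _∧_
  field
    Carrier   : Set a
    _≤ₜ_      : Carrier → Carrier → Set ℓ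
    isPartialOrder : IsPartialOrder _≡_ _≤ₜ_
    downLinear : ∀ c x y → x ≤ₜ c → y ≤ₜ c → (x ≤ₜ y) ⊎ (y ≤ₜ x)
    commonLower : ∀ x y → ∃ λ z → (z ≤ₜ x) × (z ≤ₜ y)
    _∧_       : Carrier → Carrier → Carrier
    ∧-lbˡ     : ∀ x y → x ∧ y ≤ₜ x
    ∧-lbʳ     : ∀ x y → x ∧ y ≤ₜ y
    ∧-greatest : ∀ x y z → z ≤ₜ x → z ≤ₜ y → z ≤ₜ x ∧ y

module _ {a ℓ : Level} (T : MeetTree a ℓ) where
  open MeetTree T

  _<ₜ_ : Carrier → Carrier → Set (a ⊔ ℓ)
  x <ₜ y = (x ≤ₜ y) × (x ≢ y)

  Comparable : Carrier → Carrier → Set ℓ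
  Comparable x y = (x ≤ₜ y) ⊎ (y ≤ₜ x)

  data Term (m : ℕ) : Set where
    var  : Fin m → Term m
    meet : Term m → Term m → Term m

  eval : ∀ {m} → (Fin m → Carrier) → Term m → Carrier
  eval ρ (var i)    = ρ i
  eval ρ (meet s t) = eval ρ s ∧ eval ρ t

  SameQFType : ∀ {m} → (Fin m → Carrier) → (Fin m → Carrier) → Set (a ⊔ ℓ)
  SameQFType ρ σ = ∀ s t →
    ((eval ρ s ≤ₜ eval ρ t → eval σ s ≤ₜ eval σ t) × (eval σ s ≤ₜ eval σ t → eval ρ s ≤ₜ eval ρ t))
    × ((eval ρ s ≡ eval ρ t → eval σ s ≡ eval σ t) × (eval σ s ≡ eval σ t → eval ρ s ≡ eval ρ t))

  -- (η₀,…,ηₙ) is a partial orbit: ηᵢ ↦ ηᵢ₊₁ (i < n) is a partial automorphism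
  IsPartialOrbit : ∀ n → (Fin (suc n) → Carrier) → Set (a ⊔ ℓ)
  IsPartialOrbit n η = SameQFType (λ i → η (inject₁ i)) (λ i → η (fsuc i))

  IsAscSpiral : ∀ n → (Fin (suc n) → Carrier) → ℕ → Set (a ⊔ ℓ)
  IsAscSpiral n η k = Σ (k < suc n) λ p →
    (1 ≤ k) × (η fzero <ₜ η (fromℕ< p))
    × (∀ m (q : m < k) → 1 ≤ m → ¬ (η fzero <ₜ η (fromℕ< (<-trans q p))))

  IsDescSpiral : ∀ n → (Fin (suc n) → Carrier) → ℕ → Set (a ⊔ ℓ)
  IsDescSpiral n η k = Σ (k < suc n) λ p →
    (1 ≤ k) × (η (fromℕ< p) <ₜ η fzero)
    × (∀ m (q : m < k) → 1 ≤ m → ¬ (η (fromℕ< (<-trans q p)) <ₜ η fzero))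

_≡_[mod_] : ℕ → ℕ → ℕ → Set
i ≡ j [mod k ] = k ∣ ∣ i - j ∣

idx : ∀ {m n} → m ≤ n → Fin (suc n)
idx p = fromℕ< (s≤s p)

half≤ : ∀ {l n} → 2 * l ≤ n → l ≤ n
half≤ {l} h = ≤-trans (m≤m+n l (l + 0)) h

-- Shifting indices by c is a partial automorphism of the orbit, so the spiral step η₀ ⊏ η_k (⊏ the strict
-- order in the spiral's direction) propagates to η_c ⊏ η_{c+k}; hence congruent indices give comparable
-- points. If η_i, η_j were comparable with j − i = tk + r, 0 < r < k, induction on t (using that in a tree
-- the middle of x ~ y ~ z with x ≁ z lies below both ends) reduces to r < k, which minimality of k
-- excludes. Part (2) follows because comparable points have equal meets with any point incomparable to
-- both. For (3), η₀ ∧ η_l and η_l ∧ η_{2l} lie below η_l, so they are comparable; if they differ and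
-- k ∤ l, shifting by l makes t ↦ η_{tl} ∧ η_{(t+1)l} (read on residues mod k) strictly monotone,
-- although it returns to its start at t = k.
module Submission where

open import Defs
open import Level using (_⊔_)
open import Data.Nat
  using (ℕ; zero; suc; pred; _+_; _*_; _∸_; _≤_; _<_; z≤n; s≤s; _<?_; _≟_; _%_; _/_; ∣_-_∣
        ; NonZero; ≢-nonZero)
open import Data.Nat.Properties
  using (≤-refl; ≤-trans; ≤-total; ≤-pred; <⇒≤; <-trans; m≤m+n; m≤n⇒m≤1+n; n≢0⇒n>0
        ; +-comm; +-assoc; +-identityʳ; *-comm; +-monoʳ-≤; *-monoˡ-≤; suc-pred
        ; m∸n+n≡m; m+[n∸m]≡n; m∸n≤m; m<n⇒0<n∸m; ∸-monoʳ-<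
        ; ∣-∣-comm; ∣m+n-m+o∣≡∣n-o∣; *-distribʳ-∣-∣; m≤n⇒∣m-n∣≡n∸m)
open import Data.Nat.Divisibility using (_∣_; _∣?_; divides; m%n≡0⇒n∣m)
open import Data.Nat.DivMod using (m≡m%n+[m/n]*n; m%n%n≡m%n; m%n<n; [m+kn]%n≡m%n)
open import Data.Product using (_×_; _,_; ∃; ∃₂; proj₁; proj₂)
import Data.Product as Product
open import Data.Sum using (_⊎_; inj₁; inj₂; swap)
import Data.Sum as Sum
open import Data.Fin using (Fin; zero; suc; toℕ; fromℕ<; #_)
open import Data.Fin.Properties using (fromℕ<-toℕ; toℕ-fromℕ<; toℕ-inject₁; toℕ<n; toℕ≤pred[n])
open import Data.Vec.Functional using ([]; _∷_)
open import Function.Base using (id; _∘_)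
open import Function.Bundles using (_⇔_; mk⇔; Equivalence)
open Equivalence using (to; from)
open import Function.Construct.Composition using (_⇔-∘_)
open import Function.Construct.Symmetry using (⇔-sym)
open import Relation.Binary.Core using (Rel)
open import Relation.Binary.Definitions using (Transitive)
open import Relation.Binary.Structures using (IsPartialOrder)
import Relation.Binary.Construct.Flip.EqAndOrd as Flip
import Relation.Binary.Construct.NonStrictToStrict as NonStrictToStrict
open import Relation.Binary.PropositionalEquality
  using (_≡_; _≢_; ≢-sym; refl; sym; trans; cong; cong₂; subst; subst₂; respʳ; module ≡-Reasoning)
open import Relation.Nullary using (¬_; contradiction; yes; no)
open import Relation.Nullary.Decidable using (decidable-stable)

steps⇒related : ∀ {a r} {A : Set a} {R : Rel A r} → Transitive R → (b : ℕ → A) →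
                ∀ m → (∀ t → t ≤ m → R (b t) (b (suc t))) → R (b 0) (b (suc m))
steps⇒related R-trans b zero    step = step 0 z≤n
steps⇒related {R = R} R-trans b (suc m) step =
  R-trans (steps⇒related {R = R} R-trans b m (λ t t≤m → step t (m≤n⇒m≤1+n t≤m))) (step (suc m) ≤-refl)

module _ {k : ℕ} where

  ≡[mod]-sym : ∀ i j → i ≡ j [mod k ] → j ≡ i [mod k ]
  ≡[mod]-sym i j = subst (k ∣_) (∣-∣-comm i j)

  ≡[mod]⇒+* : ∀ {i j} → i ≤ j → i ≡ j [mod k ] → ∃ λ t → j ≡ i + t * k
  ≡[mod]⇒+* {i} {j} i≤j i≡j with subst (k ∣_) (m≤n⇒∣m-n∣≡n∸m i≤j) i≡j
  ... | divides t j∸i≡t*k = t , trans (sym (m+[n∸m]≡n i≤j)) (cong (i +_) j∸i≡t*k)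

module _ {k : ℕ} .{{_ : NonZero k}} where

  private
    %≡%⇒≡[mod] : ∀ i j → i % k ≡ j % k → i ≡ j [mod k ]
    %≡%⇒≡[mod] i j i%k≡j%k = divides ∣ i / k - j / k ∣ (begin
      ∣ i - j ∣                                 ≡⟨ cong₂ ∣_-_∣ (m≡m%n+[m/n]*n i k) (m≡m%n+[m/n]*n j k) ⟩
      ∣ i % k + i / k * k - j % k + j / k * k ∣  ≡⟨ cong (λ r → ∣ r + i / k * k - j % k + j / k * k ∣) i%k≡j%k ⟩
      ∣ j % k + i / k * k - j % k + j / k * k ∣  ≡⟨ ∣m+n-m+o∣≡∣n-o∣ (j % k) (i / k * k) (j / k * k) ⟩
      ∣ i / k * k - j / k * k ∣                  ≡⟨ *-distribʳ-∣-∣ k (i / k) (j / k) ⟨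
      ∣ i / k - j / k ∣ * k                      ∎)
      where open ≡-Reasoning

    ≤-≡[mod]⇒%≡% : ∀ {i j} → i ≤ j → i ≡ j [mod k ] → j % k ≡ i % k
    ≤-≡[mod]⇒%≡% {i} i≤j i≡j with ≡[mod]⇒+* i≤j i≡j
    ... | t , refl = [m+kn]%n≡m%n i t k

    ≡[mod]⇒%≡% : ∀ i j → i ≡ j [mod k ] → i % k ≡ j % k
    ≡[mod]⇒%≡% i j i≡j with ≤-total i j
    ... | inj₁ i≤j = sym (≤-≡[mod]⇒%≡% i≤j i≡j)
    ... | inj₂ j≤i = ≤-≡[mod]⇒%≡% j≤i (≡[mod]-sym i j i≡j)

  ≡[mod]⇔%≡% : ∀ i j → i ≡ j [mod k ] ⇔ i % k ≡ j % k
  ≡[mod]⇔%≡% i j = mk⇔ (≡[mod]⇒%≡% i j) (%≡%⇒≡[mod] i j)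

  %≡%⇒+* : ∀ {i j} → i ≤ j → i % k ≡ j % k → ∃ λ t → j ≡ i + t * k
  %≡%⇒+* {i} {j} i≤j = ≡[mod]⇒+* i≤j ∘ %≡%⇒≡[mod] i j

  %≢%⇒+*+ : ∀ {i j} → i ≤ j → i % k ≢ j % k → ∃₂ λ t r → 0 < r × r < k × j ≡ i + (t * k + r)
  %≢%⇒+*+ {i} {j} i≤j i%k≢j%k = d / k , d % k , 0<d%k , m%n<n d k , j≡i+[d/k*k+d%k]
    where
    d : ℕ
    d = j ∸ i
    0<d%k : 0 < d % k
    0<d%k = n≢0⇒n>0 λ d%k≡0 → i%k≢j%k
      (≡[mod]⇒%≡% i j (subst (k ∣_) (sym (m≤n⇒∣m-n∣≡n∸m i≤j)) (m%n≡0⇒n∣m d k d%k≡0)))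
    j≡i+[d/k*k+d%k] : j ≡ i + (d / k * k + d % k)
    j≡i+[d/k*k+d%k] = begin
      j                       ≡⟨ m+[n∸m]≡n i≤j ⟨
      i + d                   ≡⟨ cong (i +_) (m≡m%n+[m/n]*n d k) ⟩
      i + (d % k + d / k * k) ≡⟨ cong (i +_) (+-comm (d % k) (d / k * k)) ⟩
      i + (d / k * k + d % k) ∎
      where open ≡-Reasoning

  +-cancelˡ-%≡% : ∀ c i j → (c + i) % k ≡ (c + j) % k → i % k ≡ j % k
  +-cancelˡ-%≡% c i j = ≡[mod]⇒%≡% i j ∘ subst (k ∣_) (∣m+n-m+o∣≡∣n-o∣ c i j) ∘ %≡%⇒≡[mod] (c + i) (c + j)

  +-congˡ-%≡% : ∀ c i j → i % k ≡ j % k → (c + i) % k ≡ (c + j) % k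
  +-congˡ-%≡% c i j = ≡[mod]⇒%≡% (c + i) (c + j) ∘ subst (k ∣_) (sym (∣m+n-m+o∣≡∣n-o∣ c i j)) ∘ %≡%⇒≡[mod] i j

data Direction : Set where
  ascending descending : Direction

module MeetTreeProperties {a ℓ} (T : MeetTree a ℓ) where
  open MeetTree T
  open IsPartialOrder isPartialOrder using () renaming (trans to ≤ₜ-trans; antisym to ≤ₜ-antisym)

  ∧-comm : ∀ x y → x ∧ y ≡ y ∧ x
  ∧-comm x y = ≤ₜ-antisym (∧-greatest y x (x ∧ y) (∧-lbʳ x y) (∧-lbˡ x y))
                          (∧-greatest x y (y ∧ x) (∧-lbʳ y x) (∧-lbˡ y x))

  ≤∧≰⇒∧≡∧ : ∀ {x y z} → x ≤ₜ y → ¬ x ≤ₜ z → x ∧ z ≡ y ∧ z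
  ≤∧≰⇒∧≡∧ {x} {y} {z} x≤y x≰z =
    ≤ₜ-antisym (∧-greatest y z (x ∧ z) (≤ₜ-trans (∧-lbˡ x z) x≤y) (∧-lbʳ x z)) y∧z≤x∧z
    where
    y∧z≤x∧z : y ∧ z ≤ₜ x ∧ z
    y∧z≤x∧z with downLinear y (y ∧ z) x (∧-lbˡ y z) x≤y
    ... | inj₁ y∧z≤x = ∧-greatest x z (y ∧ z) y∧z≤x (∧-lbʳ y z)
    ... | inj₂ x≤y∧z = contradiction (≤ₜ-trans x≤y∧z (∧-lbʳ y z)) x≰z

  comparable-sym : ∀ {x y} → Comparable T x y → Comparable T y x
  comparable-sym = swap

  comparable⇒∧≡∧ : ∀ {x y z} → Comparable T x y → ¬ Comparable T x z → ¬ Comparable T y z → x ∧ z ≡ y ∧ z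
  comparable⇒∧≡∧ (inj₁ x≤y) x≁z y≁z = ≤∧≰⇒∧≡∧ x≤y (x≁z ∘ inj₁)
  comparable⇒∧≡∧ (inj₂ y≤x) x≁z y≁z = sym (≤∧≰⇒∧≡∧ y≤x (y≁z ∘ inj₁))

  middle≤ˡ : ∀ {x y z} → Comparable T x y → Comparable T y z → ¬ Comparable T x z → y ≤ₜ x
  middle≤ˡ (inj₂ y≤x) _            x≁z = y≤x
  middle≤ˡ (inj₁ x≤y) (inj₁ y≤z)   x≁z = contradiction (inj₁ (≤ₜ-trans x≤y y≤z)) x≁z
  middle≤ˡ (inj₁ x≤y) (inj₂ z≤y)   x≁z = contradiction (downLinear _ _ _ x≤y z≤y) x≁z

  middle≤ʳ : ∀ {x y z} → Comparable T x y → Comparable T y z → ¬ Comparable T x z → y ≤ₜ z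
  middle≤ʳ x~y y~z x≁z = middle≤ˡ (comparable-sym y~z) (comparable-sym x~y) (x≁z ∘ comparable-sym)

  infix 4 _⊑⟨_⟩_ _⊏⟨_⟩_

  _⊑⟨_⟩_ : Carrier → Direction → Carrier → Set ℓ
  x ⊑⟨ ascending  ⟩ y = x ≤ₜ y
  x ⊑⟨ descending ⟩ y = y ≤ₜ x

  _⊏⟨_⟩_ : Carrier → Direction → Carrier → Set (a ⊔ ℓ)
  x ⊏⟨ d ⟩ y = x ⊑⟨ d ⟩ y × x ≢ y

  ⊑-isPartialOrder : ∀ d → IsPartialOrder _≡_ (λ x y → x ⊑⟨ d ⟩ y)
  ⊑-isPartialOrder ascending  = isPartialOrder
  ⊑-isPartialOrder descending = Flip.isPartialOrder isPartialOrder

  ⊏-trans : ∀ d {x y z} → x ⊏⟨ d ⟩ y → y ⊏⟨ d ⟩ z → x ⊏⟨ d ⟩ z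
  ⊏-trans d = NonStrictToStrict.<-trans _≡_ _ (⊑-isPartialOrder d)

  ⊏-⊑-trans : ∀ d {x y z} → x ⊏⟨ d ⟩ y → y ⊑⟨ d ⟩ z → x ⊏⟨ d ⟩ z
  ⊏-⊑-trans d = NonStrictToStrict.<-≤-trans _≡_ _ sym ⊑.trans ⊑.antisym (respʳ (λ x y → x ⊑⟨ d ⟩ y))
    where module ⊑ = IsPartialOrder (⊑-isPartialOrder d)

  ⊑⇒comparable : ∀ d {x y} → x ⊑⟨ d ⟩ y → Comparable T x y
  ⊑⇒comparable ascending  = inj₁
  ⊑⇒comparable descending = inj₂

  comparable⇒⊑⊎⊒ : ∀ d {x y} → Comparable T x y → x ⊑⟨ d ⟩ y ⊎ y ⊑⟨ d ⟩ x
  comparable⇒⊑⊎⊒ ascending  = id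
  comparable⇒⊑⊎⊒ descending = swap

  ⊏⟨descending⟩⇔>ₜ : ∀ {x y} → x ⊏⟨ descending ⟩ y ⇔ _<ₜ_ T y x
  ⊏⟨descending⟩⇔>ₜ = mk⇔ (Product.map₂ ≢-sym) (Product.map₂ ≢-sym)

  ⊏-chain⇒monotone : ∀ d {x y z} → x ⊏⟨ d ⟩ y → y ⊏⟨ d ⟩ z →
                     (_<ₜ_ T x y × _<ₜ_ T y z) ⊎ (_<ₜ_ T y x × _<ₜ_ T z y)
  ⊏-chain⇒monotone ascending  x⊏y y⊏z = inj₁ (x⊏y , y⊏z)
  ⊏-chain⇒monotone descending x⊏y y⊏z = inj₂ (to ⊏⟨descending⟩⇔>ₜ x⊏y , to ⊏⟨descending⟩⇔>ₜ y⊏z)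

  comparable∧≢⇒⊏ : ∀ {x y} → Comparable T x y → x ≢ y → ∃ λ d → x ⊏⟨ d ⟩ y
  comparable∧≢⇒⊏ (inj₁ x≤y) x≢y = ascending  , x≤y , x≢y
  comparable∧≢⇒⊏ (inj₂ y≤x) x≢y = descending , y≤x , x≢y

  -- SameQFType T ρ σ unfolds to ∀ s t → SameAtomicType (eval T ρ s) (eval T ρ t) (eval T σ s) (eval T σ t).
  SameAtomicType : Carrier → Carrier → Carrier → Carrier → Set (a ⊔ ℓ)
  SameAtomicType x y x′ y′ =
    ((x ≤ₜ y → x′ ≤ₜ y′) × (x′ ≤ₜ y′ → x ≤ₜ y)) × ((x ≡ y → x′ ≡ y′) × (x′ ≡ y′ → x ≡ y))

  SameAtomicType-refl : ∀ {x y} → SameAtomicType x y x y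
  SameAtomicType-refl = (id , id) , (id , id)

  SameAtomicType-trans : ∀ {x y x′ y′ x″ y″} →
    SameAtomicType x y x′ y′ → SameAtomicType x′ y′ x″ y″ → SameAtomicType x y x″ y″
  SameAtomicType-trans ((≤⇒ , ≤⇐) , (≡⇒ , ≡⇐)) ((≤⇒′ , ≤⇐′) , (≡⇒′ , ≡⇐′)) =
    (≤⇒′ ∘ ≤⇒ , ≤⇐ ∘ ≤⇐′) , (≡⇒′ ∘ ≡⇒ , ≡⇐ ∘ ≡⇐′)

  SameAtomicType-resp : ∀ {x y x′ y′ u v u′ v′} → x ≡ u → y ≡ v → x′ ≡ u′ → y′ ≡ v′ →
    SameAtomicType x y x′ y′ → SameAtomicType u v u′ v′
  SameAtomicType-resp refl refl refl refl same = same

  rename : ∀ {m p} → (Fin m → Fin p) → Term T m → Term T p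
  rename g (var x)    = var (g x)
  rename g (meet s t) = meet (rename g s) (rename g t)

  eval-rename : ∀ {m p} (ρ : Fin p → Carrier) (g : Fin m → Fin p) t → eval T ρ (rename g t) ≡ eval T (ρ ∘ g) t
  eval-rename ρ g (var x)    = refl
  eval-rename ρ g (meet s t) = cong₂ _∧_ (eval-rename ρ g s) (eval-rename ρ g t)

  eval-cong : ∀ {m} {ρ σ : Fin m → Carrier} → (∀ x → ρ x ≡ σ x) → ∀ t → eval T ρ t ≡ eval T σ t
  eval-cong ρ≗σ (var x)    = ρ≗σ x
  eval-cong ρ≗σ (meet s t) = cong₂ _∧_ (eval-cong ρ≗σ s) (eval-cong ρ≗σ t)

  module _ {m : ℕ} where

    SameQFType-refl : ∀ {ρ : Fin m → Carrier} → SameQFType T ρ ρ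
    SameQFType-refl s t = SameAtomicType-refl

    SameQFType-trans : ∀ {ρ σ τ : Fin m → Carrier} → SameQFType T ρ σ → SameQFType T σ τ → SameQFType T ρ τ
    SameQFType-trans ρ≈σ σ≈τ s t = SameAtomicType-trans (ρ≈σ s t) (σ≈τ s t)

    SameQFType-cong : ∀ {ρ ρ′ σ σ′ : Fin m → Carrier} → (∀ x → ρ x ≡ ρ′ x) → (∀ x → σ x ≡ σ′ x) →
                      SameQFType T ρ σ → SameQFType T ρ′ σ′
    SameQFType-cong ρ≗ρ′ σ≗σ′ ρ≈σ s t =
      SameAtomicType-resp (eval-cong ρ≗ρ′ s) (eval-cong ρ≗ρ′ t) (eval-cong σ≗σ′ s) (eval-cong σ≗σ′ t) (ρ≈σ s t)

    SameQFType-reindex : ∀ {p} {ρ σ : Fin p → Carrier} (g : Fin m → Fin p) →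
                         SameQFType T ρ σ → SameQFType T (ρ ∘ g) (σ ∘ g)
    SameQFType-reindex {ρ = ρ} {σ} g ρ≈σ s t =
      SameAtomicType-resp (eval-rename ρ g s) (eval-rename ρ g t) (eval-rename σ g s) (eval-rename σ g t)
        (ρ≈σ (rename g s) (rename g t))

    module _ {ρ σ : Fin m → Carrier} (ρ≈σ : SameQFType T ρ σ) (s t : Term T m) where

      SameQFType⇒⊑ : ∀ d → eval T ρ s ⊑⟨ d ⟩ eval T ρ t → eval T σ s ⊑⟨ d ⟩ eval T σ t
      SameQFType⇒⊑ ascending  = proj₁ (proj₁ (ρ≈σ s t))
      SameQFType⇒⊑ descending = proj₁ (proj₁ (ρ≈σ t s))

      SameQFType⇒⊏ : ∀ d → eval T ρ s ⊏⟨ d ⟩ eval T ρ t → eval T σ s ⊏⟨ d ⟩ eval T σ t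
      SameQFType⇒⊏ d (s⊑t , s≢t) = SameQFType⇒⊑ d s⊑t , s≢t ∘ proj₂ (proj₂ (ρ≈σ s t))

      SameQFType⇒comparable⁻ : Comparable T (eval T σ s) (eval T σ t) → Comparable T (eval T ρ s) (eval T ρ t)
      SameQFType⇒comparable⁻ = Sum.map (proj₂ (proj₁ (ρ≈σ s t))) (proj₂ (proj₁ (ρ≈σ t s)))

module PartialOrbit {a ℓ} (T : MeetTree a ℓ) (n : ℕ) (η : Fin (suc n) → MeetTree.Carrier T)
                    (orbit : IsPartialOrbit T n η) where
  open MeetTree T
  open MeetTreeProperties T

  -- η as a sequence indexed by ℕ; the value η₀ at indices beyond n is junk and never used.
  e : ℕ → Carrier
  e i with i <? suc n
  ... | yes i<1+n = η (fromℕ< i<1+n)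
  ... | no  _     = η zero

  e-toℕ : ∀ i → e (toℕ i) ≡ η i
  e-toℕ i with toℕ i <? suc n
  ... | yes i<1+n = cong η (fromℕ<-toℕ i i<1+n)
  ... | no  i≮1+n = contradiction (toℕ<n i) i≮1+n

  η≡e : ∀ i {m} → toℕ i ≡ m → η i ≡ e m
  η≡e i refl = sym (e-toℕ i)

  shift-suc : ∀ {m} (f : Fin m → ℕ) → (∀ x → f x < n) → SameQFType T (e ∘ f) (e ∘ suc ∘ f)
  shift-suc f f<n = SameQFType-cong
    (λ x → η≡e _ (trans (toℕ-inject₁ _) (toℕ-fromℕ< (f<n x))))
    (λ x → η≡e _ (cong suc (toℕ-fromℕ< (f<n x))))
    (SameQFType-reindex (λ x → fromℕ< (f<n x)) orbit)

  shift : ∀ c {m} (f : Fin m → ℕ) → (∀ x → c + f x ≤ n) → SameQFType T (e ∘ f) (λ x → e (c + f x))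
  shift zero    f _       = SameQFType-refl
  shift (suc c) f c+f<n   = SameQFType-trans (shift c f (<⇒≤ ∘ c+f<n)) (shift-suc (λ x → c + f x) c+f<n)

  module _ (c : ℕ) {i j : ℕ} (c+i≤n : c + i ≤ n) (c+j≤n : c + j ≤ n) where
    private
      pair : SameQFType T (e ∘ (i ∷ j ∷ [])) (λ x → e (c + (i ∷ j ∷ []) x))
      pair = shift c (i ∷ j ∷ []) λ { zero → c+i≤n ; (suc zero) → c+j≤n }

    shift-⊑ : ∀ d → e i ⊑⟨ d ⟩ e j → e (c + i) ⊑⟨ d ⟩ e (c + j)
    shift-⊑ = SameQFType⇒⊑ pair (var (# 0)) (var (# 1))

    shift-⊏ : ∀ d → e i ⊏⟨ d ⟩ e j → e (c + i) ⊏⟨ d ⟩ e (c + j)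
    shift-⊏ = SameQFType⇒⊏ pair (var (# 0)) (var (# 1))

    unshift-comparable : Comparable T (e (c + i)) (e (c + j)) → Comparable T (e i) (e j)
    unshift-comparable = SameQFType⇒comparable⁻ pair (var (# 0)) (var (# 1))

  shift-∧-⊏ : ∀ c d {x y u v} → c + x ≤ n → c + y ≤ n → c + u ≤ n → c + v ≤ n →
              e x ∧ e y ⊏⟨ d ⟩ e u ∧ e v → e (c + x) ∧ e (c + y) ⊏⟨ d ⟩ e (c + u) ∧ e (c + v)
  shift-∧-⊏ c d {x} {y} {u} {v} c+x≤n c+y≤n c+u≤n c+v≤n =
    SameQFType⇒⊏ (shift c (x ∷ y ∷ u ∷ v ∷ []) bounded) (meet (var (# 0)) (var (# 1)))
                                                     (meet (var (# 2)) (var (# 3))) d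
    where
    bounded : ∀ i → c + (x ∷ y ∷ u ∷ v ∷ []) i ≤ n
    bounded zero                   = c+x≤n
    bounded (suc zero)             = c+y≤n
    bounded (suc (suc zero))       = c+u≤n
    bounded (suc (suc (suc zero))) = c+v≤n

  record IsSpiral (d : Direction) (k : ℕ) : Set (a ⊔ ℓ) where
    field
      period≤n : k ≤ n
      returns  : e 0 ⊏⟨ d ⟩ e k
      minimal  : ∀ {m} → 0 < m → m < k → ¬ e 0 ⊏⟨ d ⟩ e m

  private
    mkSpiral : ∀ d {k} (k<1+n : k < suc n) → η zero ⊏⟨ d ⟩ η (fromℕ< k<1+n) →
               (∀ m (m<k : m < k) → 1 ≤ m → ¬ η zero ⊏⟨ d ⟩ η (fromℕ< (<-trans m<k k<1+n))) →
               IsSpiral d k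
    mkSpiral d k<1+n η₀⊏ηₖ minimal′ = record
      { period≤n = ≤-pred k<1+n
      ; returns  = subst₂ (λ x y → x ⊏⟨ d ⟩ y) (η≡e _ refl) (η≡e _ (toℕ-fromℕ< k<1+n)) η₀⊏ηₖ
      ; minimal  = λ {m} 0<m m<k e₀⊏eₘ → minimal′ m m<k 0<m
          (subst₂ (λ x y → x ⊏⟨ d ⟩ y) (sym (η≡e _ refl)) (sym (η≡e _ (toℕ-fromℕ< _))) e₀⊏eₘ)
      }

  spiral-direction : ∀ {k} → IsAscSpiral T n η k ⊎ IsDescSpiral T n η k → ∃ λ d → IsSpiral d k
  spiral-direction (inj₁ (k<1+n , _ , η₀<ηₖ , minimal)) = ascending , mkSpiral ascending k<1+n η₀<ηₖ minimal
  spiral-direction (inj₂ (k<1+n , _ , ηₖ<η₀ , minimal)) = descending ,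
    mkSpiral descending k<1+n (from ⊏⟨descending⟩⇔>ₜ ηₖ<η₀) (λ m m<k 0<m → minimal m m<k 0<m ∘ to ⊏⟨descending⟩⇔>ₜ)

  module Spiral {d : Direction} {k : ℕ} (spiral : IsSpiral d k) where
    open IsSpiral spiral
    open IsPartialOrder isPartialOrder using () renaming (reflexive to ≤ₜ-reflexive; trans to ≤ₜ-trans)
    open IsPartialOrder (⊑-isPartialOrder d) using () renaming (reflexive to ⊑-reflexive)

    private
      _⊑_ : Carrier → Carrier → Set ℓ
      x ⊑ y = x ⊑⟨ d ⟩ y

      _⊏_ : Carrier → Carrier → Set (a ⊔ ℓ)
      x ⊏ y = x ⊏⟨ d ⟩ y

    instance
      period-nonZero : NonZero k
      period-nonZero = ≢-nonZero λ { refl → proj₂ returns refl }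

    step : ∀ c → c + k ≤ n → e c ⊏ e (c + k)
    step c c+k≤n = subst (λ x → e x ⊏ e (c + k)) (+-identityʳ c)
      (shift-⊏ c (≤-trans (+-monoʳ-≤ c z≤n) c+k≤n) c+k≤n d returns)

    chain : ∀ i t → i + suc t * k ≤ n → e i ⊏ e (i + suc t * k)
    chain i t i+[1+t]k≤n =
      subst (λ x → e x ⊏ e (i + suc t * k)) (+-identityʳ i)
        (steps⇒related {R = _⊏_} (⊏-trans d) (λ s → e (i + s * k)) t stepₛ)
      where
      stepₛ : ∀ s → s ≤ t → e (i + s * k) ⊏ e (i + suc s * k)
      stepₛ s s≤t = subst (λ x → e (i + s * k) ⊏ e x) i+sk+k≡i+[1+s]k
        (step (i + s * k) (subst (_≤ n) (sym i+sk+k≡i+[1+s]k) i+[1+s]k≤n))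
        where
        i+sk+k≡i+[1+s]k : i + s * k + k ≡ i + suc s * k
        i+sk+k≡i+[1+s]k = trans (+-assoc i (s * k) k) (cong (i +_) (+-comm (s * k) k))
        i+[1+s]k≤n : i + suc s * k ≤ n
        i+[1+s]k≤n = ≤-trans (+-monoʳ-≤ i (*-monoˡ-≤ k (s≤s s≤t))) i+[1+t]k≤n

    private
      eₘ⋢e₀ : ∀ {m} → 0 < m → m < k → ¬ e m ⊑ e 0
      eₘ⋢e₀ {m} 0<m m<k eₘ⊑e₀ =
        minimal (m<n⇒0<n∸m m<k) (∸-monoʳ-< 0<m (<⇒≤ m<k)) (⊏-⊑-trans d returns eₖ⊑eₖ∸ₘ)
        where
        k∸m+m≡k : k ∸ m + m ≡ k
        k∸m+m≡k = m∸n+n≡m (<⇒≤ m<k)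
        eₖ⊑eₖ∸ₘ : e k ⊑ e (k ∸ m)
        eₖ⊑eₖ∸ₘ = subst₂ (λ x y → e x ⊑ e y) k∸m+m≡k (+-identityʳ (k ∸ m))
          (shift-⊑ (k ∸ m) (subst (_≤ n) (sym k∸m+m≡k) period≤n)
                           (subst (_≤ n) (sym (+-identityʳ (k ∸ m))) (≤-trans (m∸n≤m k m) period≤n)) d eₘ⊑e₀)

      incomparable-within-period₀ : ∀ {m} → 0 < m → m < k → ¬ Comparable T (e 0) (e m)
      incomparable-within-period₀ 0<m m<k e₀~eₘ with comparable⇒⊑⊎⊒ d e₀~eₘ
      ... | inj₂ eₘ⊑e₀ = eₘ⋢e₀ 0<m m<k eₘ⊑e₀
      ... | inj₁ e₀⊑eₘ = minimal 0<m m<k (e₀⊑eₘ , eₘ⋢e₀ 0<m m<k ∘ ⊑-reflexive ∘ sym)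

    incomparable-within-period : ∀ i {m} → 0 < m → m < k → i + m ≤ n → ¬ Comparable T (e i) (e (i + m))
    incomparable-within-period i {m} 0<m m<k i+m≤n =
      incomparable-within-period₀ 0<m m<k ∘ unshift-comparable i (≤-trans (+-monoʳ-≤ i z≤n) i+m≤n) i+m≤n
        ∘ subst (λ x → Comparable T (e x) (e (i + m))) (sym (+-identityʳ i))

    step-comparable : ∀ c → c + k ≤ n → Comparable T (e c) (e (c + k))
    step-comparable c c+k≤n = ⊑⇒comparable d (proj₁ (step c c+k≤n))

    -- With j = i + k + D: e (i + k) ~ e i and e (i + D) ~ e j, while by induction e (i + k) ≁ e j and
    -- e (i + D) ≁ e i. In a tree this forces e i ≤ e j ≤ e (i + D), contradicting e i ≁ e (i + D).
    incomparable-off-period : ∀ t i {j r} → 0 < r → r < k → j ≡ i + (t * k + r) → j ≤ n →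
                              ¬ Comparable T (e i) (e j)
    incomparable-off-period zero    i         0<r r<k refl j≤n = incomparable-within-period i 0<r r<k j≤n
    incomparable-off-period (suc t) i {j} {r} 0<r r<k j≡ j≤n eᵢ~eⱼ =
      eᵢ≁eᵢ₊D (inj₁ (≤ₜ-trans eᵢ≤eⱼ eⱼ≤eᵢ₊D))
      where
      D : ℕ
      D = t * k + r
      j≡i+k+D : j ≡ (i + k) + D
      j≡i+k+D = trans j≡ (trans (cong (i +_) (+-assoc k (t * k) r)) (sym (+-assoc i k D)))
      j≡i+D+k : j ≡ (i + D) + k
      j≡i+D+k = trans j≡i+k+D
                  (trans (+-assoc i k D) (trans (cong (i +_) (+-comm k D)) (sym (+-assoc i D k))))
      eᵢ₊ₖ≁eⱼ : ¬ Comparable T (e (i + k)) (e j)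
      eᵢ₊ₖ≁eⱼ = incomparable-off-period t (i + k) 0<r r<k j≡i+k+D j≤n
      eᵢ≁eᵢ₊D : ¬ Comparable T (e i) (e (i + D))
      eᵢ≁eᵢ₊D = incomparable-off-period t i 0<r r<k refl
                  (≤-trans (m≤m+n (i + D) k) (subst (_≤ n) j≡i+D+k j≤n))
      eᵢ₊ₖ~eᵢ : Comparable T (e (i + k)) (e i)
      eᵢ₊ₖ~eᵢ = comparable-sym (step-comparable i (≤-trans (m≤m+n (i + k) D) (subst (_≤ n) j≡i+k+D j≤n)))
      eᵢ₊D~eⱼ : Comparable T (e (i + D)) (e j)
      eᵢ₊D~eⱼ = subst (λ x → Comparable T (e (i + D)) (e x)) (sym j≡i+D+k)
                  (step-comparable (i + D) (subst (_≤ n) j≡i+D+k j≤n))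
      eᵢ≤eⱼ : e i ≤ₜ e j
      eᵢ≤eⱼ = middle≤ʳ eᵢ₊ₖ~eᵢ eᵢ~eⱼ eᵢ₊ₖ≁eⱼ
      eⱼ≤eᵢ₊D : e j ≤ₜ e (i + D)
      eⱼ≤eᵢ₊D = middle≤ˡ eᵢ₊D~eⱼ (comparable-sym eᵢ~eⱼ) (eᵢ≁eᵢ₊D ∘ comparable-sym)

    private
      ≤-comparable⇒%≡% : ∀ {i j} → i ≤ j → j ≤ n → Comparable T (e i) (e j) → i % k ≡ j % k
      ≤-comparable⇒%≡% {i} {j} i≤j j≤n eᵢ~eⱼ = decidable-stable (i % k ≟ j % k) λ i%k≢j%k →
        let t , r , 0<r , r<k , j≡ = %≢%⇒+*+ i≤j i%k≢j%k
        in incomparable-off-period t i 0<r r<k j≡ j≤n eᵢ~eⱼ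

      ≤-%≡%⇒comparable : ∀ {i j} → i ≤ j → j ≤ n → i % k ≡ j % k → Comparable T (e i) (e j)
      ≤-%≡%⇒comparable {i} i≤j j≤n i%k≡j%k with %≡%⇒+* i≤j i%k≡j%k
      ... | zero  , refl = inj₁ (≤ₜ-reflexive (cong e (sym (+-identityʳ i))))
      ... | suc t , refl = ⊑⇒comparable d (proj₁ (chain i t j≤n))

    comparable⇔%≡% : ∀ {i j} → i ≤ n → j ≤ n → Comparable T (e i) (e j) ⇔ i % k ≡ j % k
    comparable⇔%≡% {i} {j} i≤n j≤n with ≤-total i j
    ... | inj₁ i≤j = mk⇔ (≤-comparable⇒%≡% i≤j j≤n) (≤-%≡%⇒comparable i≤j j≤n)
    ... | inj₂ j≤i = mk⇔ (sym ∘ ≤-comparable⇒%≡% j≤i i≤n ∘ comparable-sym)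
                         (comparable-sym ∘ ≤-%≡%⇒comparable j≤i i≤n ∘ sym)

    ∧-%≡% : ∀ {i j l} → i ≤ n → j ≤ n → l ≤ n → i % k ≡ j % k → j % k ≢ l % k → e i ∧ e l ≡ e j ∧ e l
    ∧-%≡% i≤n j≤n l≤n i%k≡j%k j%k≢l%k = comparable⇒∧≡∧ (from (comparable⇔%≡% i≤n j≤n) i%k≡j%k)
      (j%k≢l%k ∘ trans (sym i%k≡j%k) ∘ to (comparable⇔%≡% i≤n l≤n))
      (j%k≢l%k ∘ to (comparable⇔%≡% j≤n l≤n))

    ∧-%≡%₂ : ∀ {i i′ j j′} → i ≤ n → i′ ≤ n → j ≤ n → j′ ≤ n →
             i % k ≡ i′ % k → j % k ≡ j′ % k → i % k ≢ j % k → e i ∧ e j ≡ e i′ ∧ e j′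
    ∧-%≡%₂ {i} {i′} {j} {j′} i≤n i′≤n j≤n j′≤n i≈i′ j≈j′ i≉j = begin
      e i  ∧ e j   ≡⟨ ∧-%≡% i≤n i′≤n j≤n i≈i′ (i≉j ∘ trans i≈i′) ⟩
      e i′ ∧ e j   ≡⟨ ∧-comm (e i′) (e j) ⟩
      e j  ∧ e i′  ≡⟨ ∧-%≡% j≤n j′≤n i′≤n j≈j′ (λ j′≈i′ → i≉j (trans i≈i′ (sym (trans j≈j′ j′≈i′)))) ⟩
      e j′ ∧ e i′  ≡⟨ ∧-comm (e j′) (e i′) ⟩
      e i′ ∧ e j′  ∎
      where open ≡-Reasoning

    -- The meet of the residue classes of x and y. By ∧≡⊓ it is e x ∧ e y whenever x, y ≤ n are
    -- incongruent, but it is meaningful for all x and y, so it can be shifted beyond n.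
    _⊓_ : ℕ → ℕ → Carrier
    x ⊓ y = e (x % k) ∧ e (y % k)

    private
      1+%≤n : ∀ x → suc (x % k) ≤ n
      1+%≤n x = ≤-trans (m%n<n x k) period≤n

    ∧≡⊓ : ∀ {x y} → x ≤ n → y ≤ n → x % k ≢ y % k → e x ∧ e y ≡ x ⊓ y
    ∧≡⊓ {x} {y} x≤n y≤n = ∧-%≡%₂ x≤n (<⇒≤ (1+%≤n x)) y≤n (<⇒≤ (1+%≤n y))
      (sym (m%n%n≡m%n x k)) (sym (m%n%n≡m%n y k))

    ⊓-⊏-suc : ∀ d′ {x y u v} → x % k ≢ y % k → u % k ≢ v % k →
              x ⊓ y ⊏⟨ d′ ⟩ u ⊓ v → suc x ⊓ suc y ⊏⟨ d′ ⟩ suc u ⊓ suc v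
    ⊓-⊏-suc d′ {x} {y} {u} {v} x≉y u≉v =
      subst₂ (λ X Y → X ⊏⟨ d′ ⟩ Y) (shifted≡⊓ x≉y) (shifted≡⊓ u≉v)
      ∘ shift-∧-⊏ 1 d′ (1+%≤n x) (1+%≤n y) (1+%≤n u) (1+%≤n v)
      where
      1+%≈1+ : ∀ z → suc (z % k) % k ≡ suc z % k
      1+%≈1+ z = +-congˡ-%≡% 1 (z % k) z (m%n%n≡m%n z k)
      shifted≡⊓ : ∀ {z w} → z % k ≢ w % k → e (suc (z % k)) ∧ e (suc (w % k)) ≡ suc z ⊓ suc w
      shifted≡⊓ {z} {w} z≉w = trans
        (∧≡⊓ (1+%≤n z) (1+%≤n w) λ 1+z%≈1+w% →
          z≉w (+-cancelˡ-%≡% 1 z w (trans (sym (1+%≈1+ z)) (trans 1+z%≈1+w% (1+%≈1+ w)))))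
        (cong₂ _∧_ (cong e (1+%≈1+ z)) (cong e (1+%≈1+ w)))

    ⊓-⊏-+ : ∀ d′ s {x y u v} → x % k ≢ y % k → u % k ≢ v % k →
            x ⊓ y ⊏⟨ d′ ⟩ u ⊓ v → (s + x) ⊓ (s + y) ⊏⟨ d′ ⟩ (s + u) ⊓ (s + v)
    ⊓-⊏-+ d′ zero    x≉y u≉v = id
    ⊓-⊏-+ d′ (suc s) {x} {y} {u} {v} x≉y u≉v =
      ⊓-⊏-suc d′ {s + x} {s + y} {s + u} {s + v}
        (x≉y ∘ +-cancelˡ-%≡% s x y) (u≉v ∘ +-cancelˡ-%≡% s u v) ∘ ⊓-⊏-+ d′ s x≉y u≉v

    private
      ∤⇒0≉ : ∀ {l} → ¬ k ∣ l → 0 % k ≢ l % k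
      ∤⇒0≉ {l} k∤l = k∤l ∘ from (≡[mod]⇔%≡% 0 l)

      ∤⇒≉double : ∀ {l} → ¬ k ∣ l → l % k ≢ (l + l) % k
      ∤⇒≉double {l} k∤l =
        ∤⇒0≉ k∤l ∘ +-cancelˡ-%≡% l 0 l ∘ subst (λ x → x % k ≡ (l + l) % k) (sym (+-identityʳ l))

    -- Shifting by multiples of l makes A t = (t l) ⊓ ((t + 1) l) strictly monotone, yet A k = A 0.
    ⊓-acyclic : ∀ d′ {l} → ¬ k ∣ l → ¬ 0 ⊓ l ⊏⟨ d′ ⟩ l ⊓ (l + l)
    ⊓-acyclic d′ {l} k∤l A₀⊏A₁ = proj₂ (subst (λ X → A 0 ⊏⟨ d′ ⟩ X) A-periodic A₀⊏Aₖ) refl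
      where
      A : ℕ → Carrier
      A t = (t * l) ⊓ (t * l + l)

      A-step : ∀ t → A t ⊏⟨ d′ ⟩ A (suc t)
      A-step t = subst₂ (λ X Y → X ⊏⟨ d′ ⟩ Y)
        (cong (_⊓ (t * l + l)) (+-identityʳ (t * l)))
        (cong₂ _⊓_ tl+l≡[1+t]l (trans (sym (+-assoc (t * l) l l)) (cong (_+ l) tl+l≡[1+t]l)))
        (⊓-⊏-+ d′ (t * l) {0} {l} {l} {l + l} (∤⇒0≉ k∤l) (∤⇒≉double k∤l) A₀⊏A₁)
        where
        tl+l≡[1+t]l : t * l + l ≡ suc t * l
        tl+l≡[1+t]l = +-comm (t * l) l

      A₀⊏Aₖ : A 0 ⊏⟨ d′ ⟩ A k
      A₀⊏Aₖ = subst (λ m → A 0 ⊏⟨ d′ ⟩ A m) (suc-pred k)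
        (steps⇒related {R = λ X Y → X ⊏⟨ d′ ⟩ Y} (⊏-trans d′) A (pred k) (λ t _ → A-step t))

      A-periodic : A k ≡ A 0
      A-periodic = cong₂ (λ u v → e u ∧ e v)
        (trans (cong (_% k) (*-comm k l)) ([m+kn]%n≡m%n 0 l k))
        (trans (cong (_% k) (trans (+-comm (k * l) l) (cong (l +_) (*-comm k l)))) ([m+kn]%n≡m%n l l k))

    ∧-≢⇒∣ : ∀ {l} → l + l ≤ n → e 0 ∧ e l ≢ e l ∧ e (l + l) → k ∣ l
    ∧-≢⇒∣ {l} l+l≤n e₀∧eₗ≢eₗ∧e₂ₗ = decidable-stable (k ∣? l) λ k∤l →
      let d′ , e₀∧eₗ⊏eₗ∧e₂ₗ = comparable∧≢⇒⊏ (downLinear (e l) _ _ (∧-lbʳ (e 0) (e l)) (∧-lbˡ (e l) (e (l + l))))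
                                              e₀∧eₗ≢eₗ∧e₂ₗ
      in ⊓-acyclic d′ k∤l (subst₂ (λ X Y → X ⊏⟨ d′ ⟩ Y)
           (∧≡⊓ z≤n (≤-trans (m≤m+n l l) l+l≤n) (∤⇒0≉ k∤l))
           (∧≡⊓ (≤-trans (m≤m+n l l) l+l≤n) l+l≤n (∤⇒≉double k∤l))
           e₀∧eₗ⊏eₗ∧e₂ₗ)

    ∧-≢⇒chain : ∀ {l} → l + l ≤ n → e 0 ∧ e l ≢ e l ∧ e (l + l) → k ∣ l × e 0 ⊏ e l × e l ⊏ e (l + l)
    ∧-≢⇒chain {l} l+l≤n e₀∧eₗ≢eₗ∧e₂ₗ with ∧-≢⇒∣ {l} l+l≤n e₀∧eₗ≢eₗ∧e₂ₗ
    ... | divides zero    refl = contradiction refl e₀∧eₗ≢eₗ∧e₂ₗ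
    ... | divides (suc q) refl = divides (suc q) refl , chain 0 q (≤-trans (m≤m+n l l) l+l≤n) , chain l q l+l≤n

    comparable⇔≡[mod] : ∀ i j → Comparable T (η i) (η j) ⇔ toℕ i ≡ toℕ j [mod k ]
    comparable⇔≡[mod] i j rewrite sym (e-toℕ i) | sym (e-toℕ j) =
      ⇔-sym (≡[mod]⇔%≡% (toℕ i) (toℕ j)) ⇔-∘ comparable⇔%≡% (toℕ≤pred[n] i) (toℕ≤pred[n] j)

    ∧-≡[mod] : ∀ i j l → toℕ i ≡ toℕ j [mod k ] → ¬ toℕ j ≡ toℕ l [mod k ] → η i ∧ η l ≡ η j ∧ η l
    ∧-≡[mod] i j l i≡j j≢l rewrite sym (e-toℕ i) | sym (e-toℕ j) | sym (e-toℕ l) =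
      ∧-%≡% (toℕ≤pred[n] i) (toℕ≤pred[n] j) (toℕ≤pred[n] l)
        (to (≡[mod]⇔%≡% (toℕ i) (toℕ j)) i≡j) (j≢l ∘ from (≡[mod]⇔%≡% (toℕ j) (toℕ l)))

    ∧-≢⇒∣×monotone : ∀ l (h : 2 * l ≤ n) →
      η zero ∧ η (idx (half≤ {l} h)) ≢ η (idx (half≤ {l} h)) ∧ η (idx h) →
      k ∣ l × ((_<ₜ_ T (η zero) (η (idx (half≤ {l} h))) × _<ₜ_ T (η (idx (half≤ {l} h))) (η (idx h)))
              ⊎ (_<ₜ_ T (η (idx (half≤ {l} h))) (η zero) × _<ₜ_ T (η (idx h)) (η (idx (half≤ {l} h)))))
    ∧-≢⇒∣×monotone l h rewrite η≡e zero refl | η≡e (idx (half≤ {l} h)) (toℕ-fromℕ< _)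
                             | η≡e (idx h) (trans (toℕ-fromℕ< _) (cong (l +_) (+-identityʳ l))) = λ e₀∧eₗ≢eₗ∧e₂ₗ →
      let k∣l , e₀⊏eₗ , eₗ⊏e₂ₗ = ∧-≢⇒chain (subst (_≤ n) (cong (l +_) (+-identityʳ l)) h) e₀∧eₗ≢eₗ∧e₂ₗ
      in k∣l , ⊏-chain⇒monotone d e₀⊏eₗ eₗ⊏e₂ₗ

proposition5p7 : ∀ {a ℓ} (T : MeetTree a ℓ) (n : ℕ) (η : Fin (suc n) → MeetTree.Carrier T) (k : ℕ)
    → IsPartialOrbit T n η
    → IsAscSpiral T n η k ⊎ IsDescSpiral T n η k
    → (∀ (i j : Fin (suc n)) → Comparable T (η i) (η j) ⇔ (toℕ i ≡ toℕ j [mod k ]))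
      × (∀ (i j l : Fin (suc n)) → toℕ i ≡ toℕ j [mod k ] → ¬ (toℕ j ≡ toℕ l [mod k ])
          → MeetTree._∧_ T (η i) (η l) ≡ MeetTree._∧_ T (η j) (η l))
      × (∀ (l : ℕ) (h : 2 * l ≤ n)
          → MeetTree._∧_ T (η zero) (η (idx (half≤ {l} h))) ≢ MeetTree._∧_ T (η (idx (half≤ {l} h))) (η (idx h))
          → (k ∣ l)
            × ((_<ₜ_ T (η zero) (η (idx (half≤ {l} h))) × _<ₜ_ T (η (idx (half≤ {l} h))) (η (idx h)))
              ⊎ (_<ₜ_ T (η (idx (half≤ {l} h))) (η zero) × _<ₜ_ T (η (idx h)) (η (idx (half≤ {l} h))))))
proposition5p7 T n η k orbit spiral = comparable⇔≡[mod] , ∧-≡[mod] , ∧-≢⇒∣×monotone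
  where
  open PartialOrbit T n η orbit
  open Spiral (proj₂ (spiral-direction spiral))
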